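{- There exists a $4$-GDD of type $2^2 5^5$, i.e. a $4$-GDD on $29$ points with two groups of size $2$ and five groups of size $5$.
   Context: A group divisible design with block size $k$ ($k$-GDD) is a triple $(X,\mathcal{G},\mathcal{B})$ where $X$ is a finite set of points, $\mathcal{G}$ is a partition of $X$ into parts called groups, and $\mathcal{B}$ is a collection of $k$-element subsets of $X$ called blocks, such that (1) no block meets any group in more than one point, and (2) any two points from distinct groups lie together in exactly one block. The type of a GDD is the multiset of its group sizes; in exponential notation $t_1^{u_1} t_2^{u_2}\cdots t_m^{u_m}$ means there are $u_i$ groups of size $t_i$ for each $i$. -}

module Defs where

open import Data.Nat using (ℕ)
open import Data.Fin using (Fin)
open import Data.Fin.Properties using (_≟_)
open import Data.List using (List; length; filter; map; allFin)
open import Data.List.Relation.Unary.All using (All)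
open import Data.List.Relation.Binary.Permutation.Propositional using (_↭_)
open import Data.Vec using (Vec; lookup)
open import Data.Product using (_×_)
open import Relation.Nullary.Decidable using (_×-dec_)
open import Relation.Binary.PropositionalEquality using (_≡_; _≢_)

groupSize : {v m : ℕ} → (Fin v → Fin m) → Fin m → ℕ
groupSize {v} grp i = length (filter (λ x → grp x ≟ i) (allFin v))

pairCount : {v k : ℕ} → List (Vec (Fin v) k) → Fin v → Fin v → ℕ
pairCount {v} blocks x y = length (filter (λ B → (x ∈? B) ×-dec (y ∈? B)) blocks)
  where open import Data.Vec.Membership.DecPropositional (_≟_ {v}) using (_∈?_)

-- Groups: the fibres of grp : Fin v → Fin m (group i is
-- the set of points x with grp x ≡ i).  Blocks: a list (multiset) of
-- k-tuples of points.
record GDD (k : ℕ) (type : List ℕ) : Set where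
  field
    v      : ℕ
    m      : ℕ
    grp    : Fin v → Fin m
    blocks : List (Vec (Fin v) k)

  field
    hasType    : map (groupSize grp) (allFin m) ↭ type
    -- each block meets each group in at most one point (in particular
    -- its k entries are distinct points, so it is a k-element subset)
    transverse : All (λ B → ∀ i j → i ≢ j → grp (lookup B i) ≢ grp (lookup B j)) blocks
    balanced   : ∀ x y → grp x ≢ grp y → pairCount blocks x y ≡ 1

-- Explicit design: the 406 − (2·1 + 5·10) = 354 pairs of points lying in
-- distinct groups are covered by 59 blocks of 6 pairs each.  Every GDD axiom
-- is a decidable property of finite data, so the design is verified by
-- evaluating the corresponding decision procedures.
module Submission where

open import Defs
open import Data.Nat using (ℕ)
import Data.Nat.Properties as ℕ
open import Data.Fin using (Fin; #_)
open import Data.Fin.Properties using (_≟_; all?)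
open import Data.List using (List; _∷_; []; map; allFin)
import Data.List.Relation.Unary.All as All
open import Data.List.Relation.Binary.Permutation.Propositional using (_↭_; ↭-refl)
open import Data.Vec as Vec using (Vec; lookup; replicate; _++_)
open import Relation.Binary.PropositionalEquality using (_≡_; _≢_)
open import Relation.Nullary.Decidable using (Dec; True; toWitness; ¬?; _→-dec_)
open import Relation.Unary using (Decidable)

private
  variable
    k v m : ℕ

Transversal : (Fin v → Fin m) → Vec (Fin v) k → Set
Transversal grp B = ∀ i j → i ≢ j → grp (lookup B i) ≢ grp (lookup B j)

transversal? : (grp : Fin v → Fin m) → Decidable (Transversal {k = k} grp)
transversal? grp B =
  all? λ i → all? λ j → ¬? (i ≟ j) →-dec ¬? (grp (lookup B i) ≟ grp (lookup B j))

PairBalanced : (Fin v → Fin m) → List (Vec (Fin v) k) → Set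
PairBalanced grp blocks = ∀ x y → grp x ≢ grp y → pairCount blocks x y ≡ 1

pairBalanced? : (grp : Fin v → Fin m) (blocks : List (Vec (Fin v) k)) →
                Dec (PairBalanced grp blocks)
pairBalanced? grp blocks =
  all? λ x → all? λ y → ¬? (grp x ≟ grp y) →-dec (pairCount blocks x y ℕ.≟ 1)

GDD-fromDecision : ∀ {type} (grp : Fin v → Fin m) (blocks : List (Vec (Fin v) k)) →
                   map (groupSize grp) (allFin m) ↭ type →
                   True (All.all? (transversal? grp) blocks) →
                   True (pairBalanced? grp blocks) →
                   GDD k type
GDD-fromDecision grp blocks hasType transverse balanced = record
  { grp        = grp
  ; blocks     = blocks
  ; hasType    = hasType
  ; transverse = toWitness transverse
  ; balanced   = toWitness balanced
  }

grp₂₂₅₅₅₅₅ : Fin 29 → Fin 7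
grp₂₂₅₅₅₅₅ = lookup ( replicate 2 (# 0) ++ replicate 2 (# 1) ++ replicate 5 (# 2)
                   ++ replicate 5 (# 3) ++ replicate 5 (# 4) ++ replicate 5 (# 5)
                   ++ replicate 5 (# 6))

⟨_,_,_,_⟩ : Fin v → Fin v → Fin v → Fin v → Vec (Fin v) 4
⟨ a , b , c , d ⟩ = a Vec.∷ b Vec.∷ c Vec.∷ d Vec.∷ Vec.[]

blocks₂₂₅₅₅₅₅ : List (Vec (Fin 29) 4)
blocks₂₂₅₅₅₅₅ =
  ⟨ # 0  , # 2  , # 9  , # 14 ⟩ ∷ ⟨ # 0  , # 3  , # 10 , # 15 ⟩ ∷
  ⟨ # 1  , # 4  , # 11 , # 16 ⟩ ∷ ⟨ # 2  , # 4  , # 12 , # 17 ⟩ ∷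
  ⟨ # 1  , # 2  , # 19 , # 24 ⟩ ∷ ⟨ # 1  , # 3  , # 20 , # 25 ⟩ ∷
  ⟨ # 0  , # 4  , # 21 , # 26 ⟩ ∷ ⟨ # 3  , # 4  , # 22 , # 27 ⟩ ∷
  ⟨ # 13 , # 18 , # 23 , # 28 ⟩ ∷ ⟨ # 4  , # 9  , # 18 , # 20 ⟩ ∷
  ⟨ # 4  , # 13 , # 14 , # 25 ⟩ ∷ ⟨ # 4  , # 10 , # 23 , # 24 ⟩ ∷
  ⟨ # 4  , # 15 , # 19 , # 28 ⟩ ∷ ⟨ # 5  , # 9  , # 19 , # 26 ⟩ ∷
  ⟨ # 6  , # 14 , # 21 , # 24 ⟩ ∷ ⟨ # 3  , # 9  , # 16 , # 24 ⟩ ∷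
  ⟨ # 3  , # 11 , # 14 , # 19 ⟩ ∷ ⟨ # 3  , # 5  , # 13 , # 21 ⟩ ∷
  ⟨ # 3  , # 6  , # 18 , # 26 ⟩ ∷ ⟨ # 3  , # 7  , # 17 , # 28 ⟩ ∷
  ⟨ # 3  , # 8  , # 12 , # 23 ⟩ ∷ ⟨ # 1  , # 5  , # 14 , # 23 ⟩ ∷
  ⟨ # 1  , # 6  , # 9  , # 28 ⟩ ∷ ⟨ # 7  , # 14 , # 20 , # 27 ⟩ ∷
  ⟨ # 8  , # 9  , # 22 , # 25 ⟩ ∷ ⟨ # 7  , # 9  , # 15 , # 21 ⟩ ∷
  ⟨ # 8  , # 10 , # 14 , # 26 ⟩ ∷ ⟨ # 9  , # 17 , # 23 , # 27 ⟩ ∷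
  ⟨ # 12 , # 14 , # 22 , # 28 ⟩ ∷ ⟨ # 10 , # 17 , # 21 , # 25 ⟩ ∷
  ⟨ # 12 , # 15 , # 20 , # 26 ⟩ ∷ ⟨ # 1  , # 7  , # 10 , # 22 ⟩ ∷
  ⟨ # 1  , # 8  , # 15 , # 27 ⟩ ∷ ⟨ # 1  , # 12 , # 18 , # 21 ⟩ ∷
  ⟨ # 1  , # 13 , # 17 , # 26 ⟩ ∷ ⟨ # 0  , # 7  , # 12 , # 24 ⟩ ∷
  ⟨ # 0  , # 8  , # 17 , # 19 ⟩ ∷ ⟨ # 5  , # 12 , # 16 , # 27 ⟩ ∷
  ⟨ # 6  , # 11 , # 17 , # 22 ⟩ ∷ ⟨ # 5  , # 17 , # 20 , # 24 ⟩ ∷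
  ⟨ # 6  , # 12 , # 19 , # 25 ⟩ ∷ ⟨ # 7  , # 13 , # 16 , # 19 ⟩ ∷
  ⟨ # 8  , # 11 , # 18 , # 24 ⟩ ∷ ⟨ # 0  , # 5  , # 18 , # 22 ⟩ ∷
  ⟨ # 0  , # 6  , # 13 , # 27 ⟩ ∷ ⟨ # 2  , # 5  , # 10 , # 28 ⟩ ∷
  ⟨ # 2  , # 6  , # 15 , # 23 ⟩ ∷ ⟨ # 2  , # 7  , # 18 , # 25 ⟩ ∷
  ⟨ # 2  , # 8  , # 13 , # 20 ⟩ ∷ ⟨ # 2  , # 11 , # 21 , # 27 ⟩ ∷
  ⟨ # 2  , # 16 , # 22 , # 26 ⟩ ∷ ⟨ # 5  , # 11 , # 15 , # 25 ⟩ ∷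
  ⟨ # 6  , # 10 , # 16 , # 20 ⟩ ∷ ⟨ # 0  , # 11 , # 20 , # 28 ⟩ ∷
  ⟨ # 0  , # 16 , # 23 , # 25 ⟩ ∷ ⟨ # 7  , # 11 , # 23 , # 26 ⟩ ∷
  ⟨ # 8  , # 16 , # 21 , # 28 ⟩ ∷ ⟨ # 10 , # 18 , # 19 , # 27 ⟩ ∷
  ⟨ # 13 , # 15 , # 22 , # 24 ⟩ ∷ []

lemma2p1 : GDD 4 (2 ∷ 2 ∷ 5 ∷ 5 ∷ 5 ∷ 5 ∷ 5 ∷ [])
lemma2p1 = GDD-fromDecision grp₂₂₅₅₅₅₅ blocks₂₂₅₅₅₅₅ ↭-refl _ _
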